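{- Let $Q$ be a mix lattice-ordered bisemigroup and let $d\ge 2$ be an integer. Then the set $\mathcal{L}_d(Q)$ of clopen tuples of $Q^{\mathcal{C}_d}$, ordered by the coordinatewise order inherited from $Q^{\mathcal{C}_d}$, is a lattice.
   Context: A lattice-ordered bisemigroup is a structure $\langle Q,\bot,\vee,\top,\wedge,\otimes,\oplus\rangle$ where $\langle Q,\bot,\vee,\top,\wedge\rangle$ is a bounded lattice, $\otimes$ is an associative binary operation distributing over finite joins in each variable, $\oplus$ is an associative binary operation distributing over finite meets in each variable, and the hemidistributive laws $\beta\otimes(\gamma\oplus\delta)\le(\beta\otimes\gamma)\oplus\delta$ and $(\alpha\oplus\beta)\otimes\gamma\le\alpha\oplus(\beta\otimes\gamma)$ hold for all $\alpha,\beta,\gamma,\delta\in Q$. It is mix if moreover $\alpha\otimes\beta\le\alpha\oplus\beta$ for all $\alpha,\beta$. Let $\mathcal{C}_d=\{(i,j):1\le i<j\le d\}$ and $Q^{\mathcal{C}_d}$ the product lattice with coordinatewise order. A tuple $f=(f_{i,j})_{(i,j)\in\mathcal{C}_d}$ is closed if $f_{i,j}\otimes f_{j,k}\le f_{i,k}$ for all $1\le i<j<k\le d$, open if $f_{i,k}\le f_{i,j}\oplus f_{j,k}$ for all $1\le i<j<k\le d$, and clopen if it is both closed and open. -}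

module Defs where

open import Level using (Level; _⊔_) renaming (suc to lsuc)
open import Data.Nat using (ℕ)
open import Data.Fin using (Fin; _<_)
open import Data.Fin.Properties using (<-trans)
open import Data.Product using (Σ; _×_; _,_)
open import Relation.Binary.Lattice.Bundles using (BoundedLattice)
open import Algebra.Core using (Op₂)
open import Algebra.Definitions using (Associative; Congruent₂)

record LatticeOrderedBisemigroup c ℓ₁ ℓ₂ : Set (lsuc (c ⊔ ℓ₁ ⊔ ℓ₂)) where
  infixr 8 _⊗_ _⊕_
  field
    boundedLattice : BoundedLattice c ℓ₁ ℓ₂
  open BoundedLattice boundedLattice public
  field
    _⊗_ : Op₂ Carrier
    _⊕_ : Op₂ Carrier
    ⊗-cong  : Congruent₂ _≈_ _⊗_
    ⊕-cong  : Congruent₂ _≈_ _⊕_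
    ⊗-assoc : Associative _≈_ _⊗_
    ⊕-assoc : Associative _≈_ _⊕_
    ⊗-distribˡ-∨ : ∀ a b c → (a ⊗ (b ∨ c)) ≈ ((a ⊗ b) ∨ (a ⊗ c))
    ⊗-distribʳ-∨ : ∀ a b c → ((b ∨ c) ⊗ a) ≈ ((b ⊗ a) ∨ (c ⊗ a))
    ⊗-zeroˡ-⊥    : ∀ a → (⊥ ⊗ a) ≈ ⊥
    ⊗-zeroʳ-⊥    : ∀ a → (a ⊗ ⊥) ≈ ⊥
    ⊕-distribˡ-∧ : ∀ a b c → (a ⊕ (b ∧ c)) ≈ ((a ⊕ b) ∧ (a ⊕ c))
    ⊕-distribʳ-∧ : ∀ a b c → ((b ∧ c) ⊕ a) ≈ ((b ⊕ a) ∧ (c ⊕ a))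
    ⊕-zeroˡ-⊤    : ∀ a → (⊤ ⊕ a) ≈ ⊤
    ⊕-zeroʳ-⊤    : ∀ a → (a ⊕ ⊤) ≈ ⊤
    hemi₁ : ∀ β γ δ → (β ⊗ (γ ⊕ δ)) ≤ ((β ⊗ γ) ⊕ δ)
    hemi₂ : ∀ α β γ → ((α ⊕ β) ⊗ γ) ≤ (α ⊕ (β ⊗ γ))

IsMix : ∀ {c ℓ₁ ℓ₂} → LatticeOrderedBisemigroup c ℓ₁ ℓ₂ → Set (c ⊔ ℓ₂)
IsMix Q = ∀ a b → (a ⊗ b) ≤ (a ⊕ b)
  where open LatticeOrderedBisemigroup Q

module _ {c ℓ₁ ℓ₂} (Q : LatticeOrderedBisemigroup c ℓ₁ ℓ₂) where
  open LatticeOrderedBisemigroup Q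

  -- Elements of Q^{C_d}: C_d = {(i,j) : i < j} with indices in Fin d
  -- (0-based instead of 1-based).
  Tuple : ℕ → Set c
  Tuple d = (i j : Fin d) → i < j → Carrier

  _≤ₜ_ : ∀ {d} → Tuple d → Tuple d → Set ℓ₂
  f ≤ₜ g = ∀ i j (p : i < j) → f i j p ≤ g i j p

  IsClosed : ∀ {d} → Tuple d → Set ℓ₂
  IsClosed f = ∀ i j k (p : i < j) (q : j < k) →
    (f i j p ⊗ f j k q) ≤ f i k (<-trans p q)

  IsOpen : ∀ {d} → Tuple d → Set ℓ₂
  IsOpen f = ∀ i j k (p : i < j) (q : j < k) →
    f i k (<-trans p q) ≤ (f i j p ⊕ f j k q)

  IsClopen : ∀ {d} → Tuple d → Set ℓ₂
  IsClopen f = IsClosed f × IsOpen f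

  IsClopenJoin : ∀ {d} → Tuple d → Tuple d → Tuple d → Set (c ⊔ ℓ₂)
  IsClopenJoin {d} f g h =
    IsClopen h × f ≤ₜ h × g ≤ₜ h ×
    (∀ (k : Tuple d) → IsClopen k → f ≤ₜ k → g ≤ₜ k → h ≤ₜ k)

  IsClopenMeet : ∀ {d} → Tuple d → Tuple d → Tuple d → Set (c ⊔ ℓ₂)
  IsClopenMeet {d} f g h =
    IsClopen h × h ≤ₜ f × h ≤ₜ g ×
    (∀ (k : Tuple d) → IsClopen k → k ≤ₜ f → k ≤ₜ g → k ≤ₜ h)

  ClopenIsLattice : ℕ → Set (c ⊔ ℓ₂)
  ClopenIsLattice d =
    Σ (Tuple d) IsClopen ×
    (∀ (f g : Tuple d) → IsClopen f → IsClopen g →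
       Σ (Tuple d) (IsClopenJoin f g) × Σ (Tuple d) (IsClopenMeet f g))

-- The join of two clopen tuples f and g is the closure of their pointwise
-- join f ∨ g, computed as in the Floyd–Warshall algorithm: for each index m
-- in turn, every entry (i, k) with i < m < k is enlarged by the composite
-- (i, m) ⊗ (m, k). After the pass through m the tuple is closed at all middle
-- indices ≤ m, and every pass preserves openness: the new composite is split
-- at the middle index j of an open inequality by openness of the old tuple and
-- one hemidistributive law (j ≠ m) or by the mix law (j = m). The result is
-- the least closed tuple above f ∨ g, hence the least clopen one. Meets follow
-- by duality: reversing the order and exchanging ⊗ with ⊕ gives again a mix
-- lattice-ordered bisemigroup, whose clopen joins are the clopen meets of Q.
module Submission where

open import Defs
open import Level using (Level)
open import Data.Nat using (ℕ; zero; suc)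
import Data.Nat as ℕ
import Data.Nat.Properties as ℕ
open import Data.Fin using (Fin; toℕ; fromℕ<; _<_)
open import Data.Fin.Properties using (_<?_; <-cmp; <-trans; toℕ-injective; toℕ-fromℕ<; toℕ<n)
open import Data.Product using (Σ; _,_; swap)
open import Data.Sum using (inj₁; inj₂)
open import Data.Empty using (⊥-elim)
open import Function using (flip)
open import Relation.Nullary using (yes; no)
open import Relation.Binary.Definitions using (tri<; tri≈; tri>)
import Relation.Binary.PropositionalEquality as ≡
open ≡ using (_≡_)
open import Relation.Binary.Lattice.Properties.Lattice using (∧-∨-isLattice)
import Relation.Binary.Lattice.Properties.JoinSemilattice as JoinSemilatticeProperties
import Relation.Binary.Reasoning.PartialOrder as ≤-Reasoning

dual : ∀ {c ℓ₁ ℓ₂} → LatticeOrderedBisemigroup c ℓ₁ ℓ₂ → LatticeOrderedBisemigroup c ℓ₁ ℓ₂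
dual Q = record
  { boundedLattice = record
      { _≤_ = flip _≤_ ; _∨_ = _∧_ ; _∧_ = _∨_ ; ⊤ = ⊥ ; ⊥ = ⊤
      ; isBoundedLattice = record
          { isLattice = ∧-∨-isLattice lattice ; maximum = minimum ; minimum = maximum } }
  ; _⊗_ = _⊕_ ; _⊕_ = _⊗_
  ; ⊗-cong = ⊕-cong ; ⊕-cong = ⊗-cong ; ⊗-assoc = ⊕-assoc ; ⊕-assoc = ⊗-assoc
  ; ⊗-distribˡ-∨ = ⊕-distribˡ-∧ ; ⊗-distribʳ-∨ = ⊕-distribʳ-∧
  ; ⊗-zeroˡ-⊥ = ⊕-zeroˡ-⊤ ; ⊗-zeroʳ-⊥ = ⊕-zeroʳ-⊤
  ; ⊕-distribˡ-∧ = ⊗-distribˡ-∨ ; ⊕-distribʳ-∧ = ⊗-distribʳ-∨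
  ; ⊕-zeroˡ-⊤ = ⊗-zeroˡ-⊥ ; ⊕-zeroʳ-⊤ = ⊗-zeroʳ-⊥
  ; hemi₁ = hemi₂ ; hemi₂ = hemi₁ }
  where open LatticeOrderedBisemigroup Q

module ⊗-Monotonicity {c ℓ₁ ℓ₂} (Q : LatticeOrderedBisemigroup c ℓ₁ ℓ₂) where
  open LatticeOrderedBisemigroup Q
  open JoinSemilatticeProperties joinSemilattice using (x≤y⇒x∨y≈y)
  open ≤-Reasoning poset

  ⊗-monoʳ : ∀ a {b b′} → b ≤ b′ → a ⊗ b ≤ a ⊗ b′
  ⊗-monoʳ a {b} {b′} b≤b′ = begin
    a ⊗ b              ≤⟨ x≤x∨y _ _ ⟩
    a ⊗ b ∨ a ⊗ b′     ≈⟨ Eq.sym (⊗-distribˡ-∨ a b b′) ⟩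
    a ⊗ (b ∨ b′)       ≈⟨ ⊗-cong Eq.refl (x≤y⇒x∨y≈y b≤b′) ⟩
    a ⊗ b′             ∎

  ⊗-monoˡ : ∀ a {b b′} → b ≤ b′ → b ⊗ a ≤ b′ ⊗ a
  ⊗-monoˡ a {b} {b′} b≤b′ = begin
    b ⊗ a              ≤⟨ x≤x∨y _ _ ⟩
    b ⊗ a ∨ b′ ⊗ a     ≈⟨ Eq.sym (⊗-distribʳ-∨ a b b′) ⟩
    (b ∨ b′) ⊗ a       ≈⟨ ⊗-cong (x≤y⇒x∨y≈y b≤b′) Eq.refl ⟩
    b′ ⊗ a             ∎

  ⊗-mono : ∀ {a a′ b b′} → a ≤ a′ → b ≤ b′ → a ⊗ b ≤ a′ ⊗ b′
  ⊗-mono {a′ = a′} a≤a′ b≤b′ = trans (⊗-monoˡ _ a≤a′) (⊗-monoʳ a′ b≤b′)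

⊕-mono : ∀ {c ℓ₁ ℓ₂} (Q : LatticeOrderedBisemigroup c ℓ₁ ℓ₂) →
         let open LatticeOrderedBisemigroup Q in
         ∀ {a a′ b b′} → a ≤ a′ → b ≤ b′ → a ⊕ b ≤ a′ ⊕ b′
⊕-mono Q a≤a′ b≤b′ = ⊗-Monotonicity.⊗-mono (dual Q) a≤a′ b≤b′

module Closure {c ℓ₁ ℓ₂} (Q : LatticeOrderedBisemigroup c ℓ₁ ℓ₂) {d : ℕ} where
  open LatticeOrderedBisemigroup Q
  open JoinSemilatticeProperties joinSemilattice using (∨-monotonic)
  open ⊗-Monotonicity Q
  open ≤-Reasoning poset

  entry-irrelevant : (g : Tuple Q d) {i j : Fin d} (p q : i < j) → g i j p ≡ g i j q
  entry-irrelevant g p q = ≡.cong (g _ _) (ℕ.<-irrelevant p q)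

  entry-≤ : (g : Tuple Q d) {i j : Fin d} (p q : i < j) → g i j p ≤ g i j q
  entry-≤ g p q = reflexive (Eq.reflexive (entry-irrelevant g p q))

  through : Fin d → Tuple Q d → Fin d → Fin d → Carrier
  through m g i k with i <? m | m <? k
  ... | yes i<m | yes m<k = g i m i<m ⊗ g m k m<k
  ... | _       | _       = ⊥

  ≤-through : ∀ {m} (g : Tuple Q d) {i k} (i<m : i < m) (m<k : m < k) →
              g i m i<m ⊗ g m k m<k ≤ through m g i k
  ≤-through {m} g {i} {k} i<m m<k with i <? m | m <? k
  ... | yes i<m′ | yes m<k′ = ⊗-mono (entry-≤ g i<m i<m′) (entry-≤ g m<k m<k′)
  ... | no i≮m   | _        = ⊥-elim (i≮m i<m)
  ... | yes _    | no m≮k   = ⊥-elim (m≮k m<k)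

  through-≤ : ∀ m (g : Tuple Q d) i k {x} →
              (∀ i<m m<k → g i m i<m ⊗ g m k m<k ≤ x) → through m g i k ≤ x
  through-≤ m g i k {x} bound with i <? m | m <? k
  ... | yes i<m | yes m<k = bound i<m m<k
  ... | yes _   | no _    = minimum x
  ... | no _    | _       = minimum x

  ⊗-through-≤ : ∀ m (g : Tuple Q d) i k {a x} →
                (∀ i<m m<k → a ⊗ (g i m i<m ⊗ g m k m<k) ≤ x) → a ⊗ through m g i k ≤ x
  ⊗-through-≤ m g i k {a} {x} bound with i <? m | m <? k
  ... | yes i<m | yes m<k = bound i<m m<k
  ... | yes _   | no _    = trans (reflexive (⊗-zeroʳ-⊥ a)) (minimum x)
  ... | no _    | _       = trans (reflexive (⊗-zeroʳ-⊥ a)) (minimum x)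

  relax : Fin d → Tuple Q d → Tuple Q d
  relax m g i k i<k = g i k i<k ∨ through m g i k

  relax-extensive : ∀ m (g : Tuple Q d) → _≤ₜ_ Q g (relax m g)
  relax-extensive m g i k i<k = x≤x∨y _ _

  relax-least : ∀ m (g h : Tuple Q d) → IsClosed Q h → _≤ₜ_ Q g h → _≤ₜ_ Q (relax m g) h
  relax-least m g h closed g≤h i k i<k = ∨-least (g≤h i k i<k) (through-≤ m g i k composite≤h)
    where
    composite≤h : ∀ i<m m<k → g i m i<m ⊗ g m k m<k ≤ h i k i<k
    composite≤h i<m m<k = begin
      g i m i<m ⊗ g m k m<k       ≤⟨ ⊗-mono (g≤h i m i<m) (g≤h m k m<k) ⟩
      h i m i<m ⊗ h m k m<k       ≤⟨ closed i m k i<m m<k ⟩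
      h i k (<-trans i<m m<k)     ≡⟨ entry-irrelevant h _ i<k ⟩
      h i k i<k                   ∎

  relax-below : ∀ m (g : Tuple Q d) {i k} (i<k : i < k) → toℕ k ℕ.≤ toℕ m →
                relax m g i k i<k ≤ g i k i<k
  relax-below m g {i} {k} i<k k≤m =
    ∨-least refl (through-≤ m g i k λ _ m<k → ⊥-elim (ℕ.<⇒≱ m<k k≤m))

  relax-above : ∀ m (g : Tuple Q d) {i k} (i<k : i < k) → toℕ m ℕ.≤ toℕ i →
                relax m g i k i<k ≤ g i k i<k
  relax-above m g {i} {k} i<k m≤i =
    ∨-least refl (through-≤ m g i k λ i<m _ → ⊥-elim (ℕ.<⇒≱ i<m m≤i))

  relax-open : IsMix Q → ∀ m (g : Tuple Q d) → IsOpen Q g → IsOpen Q (relax m g)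
  relax-open mix m g open′ i j k i<j j<k =
    ∨-least (trans (open′ i j k i<j j<k) (⊕-mono Q (x≤x∨y _ _) (x≤x∨y _ _)))
            (through-≤ m g i k split)
    where
    split : ∀ i<m m<k → g i m i<m ⊗ g m k m<k ≤ relax m g i j i<j ⊕ relax m g j k j<k
    split i<m m<k with <-cmp m j
    ... | tri< m<j _ _ = begin
      g i m i<m ⊗ g m k m<k                ≤⟨ ⊗-monoʳ _ (trans (entry-≤ g _ _) (open′ m j k m<j j<k)) ⟩
      g i m i<m ⊗ (g m j m<j ⊕ g j k j<k)  ≤⟨ hemi₁ _ _ _ ⟩
      (g i m i<m ⊗ g m j m<j) ⊕ g j k j<k  ≤⟨ ⊕-mono Q (trans (≤-through g i<m m<j) (y≤x∨y _ _)) (x≤x∨y _ _) ⟩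
      relax m g i j i<j ⊕ relax m g j k j<k ∎
    ... | tri≈ _ ≡.refl _ = begin
      g i m i<m ⊗ g m k m<k                ≤⟨ mix _ _ ⟩
      g i m i<m ⊕ g m k m<k                ≤⟨ ⊕-mono Q (trans (entry-≤ g _ _) (x≤x∨y _ _)) (trans (entry-≤ g _ _) (x≤x∨y _ _)) ⟩
      relax m g i j i<j ⊕ relax m g j k j<k ∎
    ... | tri> _ _ j<m = begin
      g i m i<m ⊗ g m k m<k                ≤⟨ ⊗-monoˡ _ (trans (entry-≤ g _ _) (open′ i j m i<j j<m)) ⟩
      (g i j i<j ⊕ g j m j<m) ⊗ g m k m<k  ≤⟨ hemi₂ _ _ _ ⟩
      g i j i<j ⊕ (g j m j<m ⊗ g m k m<k)  ≤⟨ ⊕-mono Q (x≤x∨y _ _) (trans (≤-through g j<m m<k) (y≤x∨y _ _)) ⟩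
      relax m g i j i<j ⊕ relax m g j k j<k ∎

  ClosedBelow : ℕ → Tuple Q d → Set ℓ₂
  ClosedBelow n g = ∀ i j k (i<j : i < j) (j<k : j < k) → toℕ j ℕ.< n →
                    g i j i<j ⊗ g j k j<k ≤ g i k (<-trans i<j j<k)

  relax-closedBelow : ∀ {m n} (g : Tuple Q d) → toℕ m ≡ n →
                      ClosedBelow n g → ClosedBelow (suc n) (relax m g)
  relax-closedBelow {m} g ≡.refl closed i j k i<j j<k j<1+m with ℕ.m<1+n⇒m<n∨m≡n j<1+m
  ... | inj₁ j<m = begin
    relax m g i j i<j ⊗ relax m g j k j<k
      ≤⟨ ⊗-monoˡ _ (relax-below m g i<j (ℕ.<⇒≤ j<m)) ⟩
    g i j i<j ⊗ (g j k j<k ∨ through m g j k)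
      ≈⟨ ⊗-distribˡ-∨ _ _ _ ⟩
    g i j i<j ⊗ g j k j<k ∨ g i j i<j ⊗ through m g j k
      ≤⟨ ∨-monotonic (closed i j k i<j j<k j<m) (⊗-through-≤ m g j k reassociate) ⟩
    relax m g i k (<-trans i<j j<k)
      ∎
    where
    reassociate : ∀ j<m m<k → g i j i<j ⊗ (g j m j<m ⊗ g m k m<k) ≤ through m g i k
    reassociate j<m′ m<k = begin
      g i j i<j ⊗ (g j m j<m′ ⊗ g m k m<k)  ≈⟨ Eq.sym (⊗-assoc _ _ _) ⟩
      (g i j i<j ⊗ g j m j<m′) ⊗ g m k m<k  ≤⟨ ⊗-monoˡ _ (closed i j m i<j j<m′ j<m) ⟩
      g i m (<-trans i<j j<m′) ⊗ g m k m<k  ≤⟨ ≤-through g _ m<k ⟩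
      through m g i k                       ∎
  ... | inj₂ j≡m with toℕ-injective j≡m
  ... | ≡.refl = begin
    relax m g i m i<j ⊗ relax m g m k j<k
      ≤⟨ ⊗-mono (relax-below m g i<j ℕ.≤-refl) (relax-above m g j<k ℕ.≤-refl) ⟩
    g i m i<j ⊗ g m k j<k
      ≤⟨ ≤-through g i<j j<k ⟩
    through m g i k
      ≤⟨ y≤x∨y _ _ ⟩
    relax m g i k (<-trans i<j j<k)
      ∎

  relaxBelow : Tuple Q d → (n : ℕ) → n ℕ.≤ d → Tuple Q d
  relaxBelow f zero    _   = f
  relaxBelow f (suc n) n<d = relax (fromℕ< n<d) (relaxBelow f n (ℕ.<⇒≤ n<d))

  relaxBelow-extensive : ∀ f n (n≤d : n ℕ.≤ d) → _≤ₜ_ Q f (relaxBelow f n n≤d)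
  relaxBelow-extensive f zero    _   i k i<k = refl
  relaxBelow-extensive f (suc n) n<d i k i<k =
    trans (relaxBelow-extensive f n _ i k i<k) (relax-extensive (fromℕ< n<d) _ i k i<k)

  relaxBelow-least : ∀ f (h : Tuple Q d) → IsClosed Q h → _≤ₜ_ Q f h →
                     ∀ n (n≤d : n ℕ.≤ d) → _≤ₜ_ Q (relaxBelow f n n≤d) h
  relaxBelow-least f h closed f≤h zero    _   = f≤h
  relaxBelow-least f h closed f≤h (suc n) n<d =
    relax-least (fromℕ< n<d) _ h closed (relaxBelow-least f h closed f≤h n _)

  relaxBelow-open : IsMix Q → ∀ f → IsOpen Q f → ∀ n (n≤d : n ℕ.≤ d) → IsOpen Q (relaxBelow f n n≤d)
  relaxBelow-open mix f open′ zero    _   = open′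
  relaxBelow-open mix f open′ (suc n) n<d = relax-open mix (fromℕ< n<d) _ (relaxBelow-open mix f open′ n _)

  relaxBelow-closedBelow : ∀ f n (n≤d : n ℕ.≤ d) → ClosedBelow n (relaxBelow f n n≤d)
  relaxBelow-closedBelow f zero    _   i j k i<j j<k ()
  relaxBelow-closedBelow f (suc n) n<d =
    relax-closedBelow _ (toℕ-fromℕ< n<d) (relaxBelow-closedBelow f n _)

  closure : Tuple Q d → Tuple Q d
  closure f = relaxBelow f d ℕ.≤-refl

  closure-closed : ∀ f → IsClosed Q (closure f)
  closure-closed f i j k i<j j<k = relaxBelow-closedBelow f d ℕ.≤-refl i j k i<j j<k (toℕ<n j)

module _ {c ℓ₁ ℓ₂} (Q : LatticeOrderedBisemigroup c ℓ₁ ℓ₂) {d : ℕ} where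
  open LatticeOrderedBisemigroup Q
  open Closure Q

  _∨ₜ_ : Tuple Q d → Tuple Q d → Tuple Q d
  (f ∨ₜ g) i k i<k = f i k i<k ∨ g i k i<k

  IsOpen-∨ₜ : ∀ {f g} → IsOpen Q f → IsOpen Q g → IsOpen Q (f ∨ₜ g)
  IsOpen-∨ₜ f-open g-open i j k i<j j<k =
    ∨-least (trans (f-open i j k i<j j<k) (⊕-mono Q (x≤x∨y _ _) (x≤x∨y _ _)))
            (trans (g-open i j k i<j j<k) (⊕-mono Q (y≤x∨y _ _) (y≤x∨y _ _)))

  ⊥-clopen : Σ (Tuple Q d) (IsClopen Q)
  ⊥-clopen = (λ _ _ _ → ⊥) , (λ _ _ _ _ _ → reflexive (⊗-zeroˡ-⊥ ⊥)) , (λ _ _ _ _ _ → minimum _)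

  clopenJoin : IsMix Q → ∀ f g → IsClopen Q f → IsClopen Q g → Σ (Tuple Q d) (IsClopenJoin Q f g)
  clopenJoin mix f g (_ , f-open) (_ , g-open) =
    closure (f ∨ₜ g) ,
    (closure-closed (f ∨ₜ g) , relaxBelow-open mix (f ∨ₜ g) (IsOpen-∨ₜ f-open g-open) d ℕ.≤-refl) ,
    (λ i k i<k → trans (x≤x∨y _ _) (relaxBelow-extensive (f ∨ₜ g) d ℕ.≤-refl i k i<k)) ,
    (λ i k i<k → trans (y≤x∨y _ _) (relaxBelow-extensive (f ∨ₜ g) d ℕ.≤-refl i k i<k)) ,
    λ h (h-closed , _) f≤h g≤h →
      relaxBelow-least (f ∨ₜ g) h h-closed (λ i k i<k → ∨-least (f≤h i k i<k) (g≤h i k i<k)) d ℕ.≤-refl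

clopenMeet : ∀ {c ℓ₁ ℓ₂} (Q : LatticeOrderedBisemigroup c ℓ₁ ℓ₂) → IsMix Q → ∀ {d} f g →
             IsClopen Q f → IsClopen Q g → Σ (Tuple Q d) (IsClopenMeet Q f g)
clopenMeet Q mix f g (f-closed , f-open) (g-closed , g-open)
  with clopenJoin (dual Q) mix f g (f-open , f-closed) (g-open , g-closed)
... | h , h-clopen , h≤f , h≤g , greatest =
  h , swap h-clopen , h≤f , h≤g , λ k (k-closed , k-open) → greatest k (k-open , k-closed)

open import Data.Nat using (_≤_)

mainTheorem1 : ∀ {c ℓ₁ ℓ₂ : Level} (Q : LatticeOrderedBisemigroup c ℓ₁ ℓ₂) →
    IsMix Q → (d : ℕ) → 2 ≤ d → ClopenIsLattice Q d
mainTheorem1 Q mix d _ = ⊥-clopen Q , λ f g f-clopen g-clopen →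
  clopenJoin Q mix f g f-clopen g-clopen , clopenMeet Q mix f g f-clopen g-clopen
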